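{- Let $G$ be a finite (directed or undirected) graph and $(p_v)_{v\in V(G)}$ a probability distribution on $V(G)$. Every shortest chase path is simple, i.e., it contains no vertex more than once.
   Context: Game: $N(v)$ is the set consisting of $v$ and all $w$ with $(v,w)\in E(G)$. In each round the gambler independently chooses a vertex according to $(p_v)$; if it equals the cop's current vertex the cop wins, otherwise the cop moves to a vertex of $N(\text{current vertex})$. $T(v)$ is the optimal expected number of rounds until capture when the cop is at vertex $v$ at the start of a round (that round counted). A chase path is a sequence of vertices $(v_0,\dots,v_m)$ with $v_{j+1}\in N(v_j)$ and $T(v_j)=1+(1-p_{v_j})T(v_{j+1})$ for $0\le j\le m-1$, and $T(v_m)=1+(1-p_{v_m})T(v_m)$; its length is its number of vertices. A chase path starting at $v$ is a shortest chase path if there is no shorter chase path starting at $v$.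
   Formalization: The probabilities $p_v$ are rational, so the values $T(v)$ are taken in the rationals together with ∞. -}

module Defs where

open import Data.Nat using (ℕ; _≤_)
open import Data.Fin using (Fin)
open import Data.Rational using (ℚ; 0ℚ; 1ℚ; _+_; _-_; _*_) renaming (_≤_ to _≤ℚ_)
open import Data.Rational.Properties using () renaming (_≟_ to _≟ℚ_)
open import Data.List using (List; []; _∷_; length; foldr; map; allFin)
open import Data.List.Relation.Unary.Unique.Propositional using (Unique)
open import Data.Product using (_×_)
open import Data.Sum using (_⊎_)
open import Data.Empty using (⊥)
open import Relation.Binary.PropositionalEquality using (_≡_)
open import Relation.Nullary using (yes; no)

-- A finite (directed) graph on vertex set Fin n: an arbitrary edge relation.
-- Undirected graphs are the case of a symmetric relation.
Graph : ℕ → Set₁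
Graph n = Fin n → Fin n → Set

InN : ∀ {n} → Graph n → Fin n → Fin n → Set
InN E v w = (w ≡ v) ⊎ E v w

sumℚ : ∀ {n} → (Fin n → ℚ) → ℚ
sumℚ {n} p = foldr _+_ 0ℚ (map p (allFin n))

IsDistribution : ∀ {n} → (Fin n → ℚ) → Set
IsDistribution p = (∀ v → 0ℚ ≤ℚ p v) × (sumℚ p ≡ 1ℚ)

-- Nonnegative extended values: expected capture times may be infinite.
data ℚ∞ : Set where
  fin : ℚ → ℚ∞
  ∞   : ℚ∞

-- x ↦ 1 + (1 - q) · x  on ℚ ∪ {∞}, with the convention 0 · ∞ = 0.
oneStep : ℚ → ℚ∞ → ℚ∞
oneStep q (fin x) = fin (1ℚ + ((1ℚ - q) * x))
oneStep q ∞ with q ≟ℚ 1ℚ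
... | yes _ = fin 1ℚ
... | no _  = ∞

IsChasePath : ∀ {n} → Graph n → (Fin n → ℚ) → (Fin n → ℚ∞) → List (Fin n) → Set
IsChasePath E p T [] = ⊥
IsChasePath E p T (v ∷ []) = T v ≡ oneStep (p v) (T v)
IsChasePath E p T (v ∷ w ∷ rest) =
  InN E v w × (T v ≡ oneStep (p v) (T w)) × IsChasePath E p T (w ∷ rest)

StartsAt : ∀ {n} → List (Fin n) → Fin n → Set
StartsAt [] v = ⊥
StartsAt (u ∷ _) v = u ≡ v

IsShortestChasePath : ∀ {n} → Graph n → (Fin n → ℚ) → (Fin n → ℚ∞) → Fin n → List (Fin n) → Set
IsShortestChasePath E p T v ps =
  IsChasePath E p T ps × StartsAt ps v ×
  (∀ qs → IsChasePath E p T qs → StartsAt qs v → length ps ≤ length qs)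

{-# OPTIONS --safe #-}
-- A chase path is a local condition on consecutive vertices. So if it visits x
-- twice, its suffix from the second visit is a chase path starting at x, and
-- prefixing the part before the first visit gives a chase path from the same
-- start that is strictly shorter. Neither the distribution nor the meaning of T
-- plays any role.
module Submission where

open import Defs
open import Data.Nat using (ℕ; suc; _≤_; s≤s)
open import Data.Nat.Properties using (≤-refl; ≤-trans; m≤n⇒m≤1+n; 1+n≰n)
open import Data.Fin using (Fin; _≟_)
open import Data.Rational using (ℚ)
open import Data.List using (List; []; _∷_; length)
open import Data.List.Membership.Propositional using (_∈_)
import Data.List.Membership.DecPropositional as DecMembership
open import Data.List.Relation.Unary.All using ([])
open import Data.List.Relation.Unary.Any using (here; there)
open import Data.List.Relation.Unary.All.Properties using (¬Any⇒All¬)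
open import Data.List.Relation.Unary.AllPairs using ([]; _∷_)
open import Data.List.Relation.Unary.Unique.Propositional using (Unique)
open import Data.Product using (Σ; _×_; _,_)
open import Data.Sum using (_⊎_; inj₁; inj₂)
open import Data.Empty using (⊥-elim)
open import Relation.Binary.PropositionalEquality using (_≡_; refl)
open import Relation.Nullary using (yes; no)

module _ {n : ℕ} (E : Graph n) (p : Fin n → ℚ) (T : Fin n → ℚ∞) where

  open DecMembership (_≟_ {n}) using (_∈?_)

  ChasePathWithin : Fin n → ℕ → Set
  ChasePathWithin x k =
    Σ (List (Fin n)) λ qs → IsChasePath E p T qs × StartsAt qs x × length qs ≤ k

  chasePathWithin-suc : ∀ {x k} → ChasePathWithin x k → ChasePathWithin x (suc k)
  chasePathWithin-suc (qs , cq , sq , lq) = qs , cq , sq , m≤n⇒m≤1+n lq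

  chasePath-cons : ∀ {x w k} → InN E x w → T x ≡ oneStep (p x) (T w) →
    ChasePathWithin w k → ChasePathWithin x (suc k)
  chasePath-cons {x} x→w step (w ∷ qs , cq , refl , lq) =
    x ∷ w ∷ qs , (x→w , step , cq) , refl , s≤s lq

  chasePath-suffix : ∀ {x} ys → IsChasePath E p T ys → x ∈ ys →
    ChasePathWithin x (length ys)
  chasePath-suffix (y ∷ ys) cy (here refl) = y ∷ ys , cy , refl , ≤-refl
  chasePath-suffix (y ∷ z ∷ ys) (_ , _ , cz) (there x∈) =
    chasePathWithin-suc (chasePath-suffix (z ∷ ys) cz x∈)

  chasePath-unique⊎shortcut : ∀ x ys → IsChasePath E p T (x ∷ ys) →
    Unique (x ∷ ys) ⊎ ChasePathWithin x (length ys)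
  chasePath-unique⊎shortcut x [] _ = inj₁ ([] ∷ [])
  chasePath-unique⊎shortcut x (w ∷ ys) (x→w , step , cw)
    with chasePath-unique⊎shortcut w ys cw
  ... | inj₂ shortcut = inj₂ (chasePath-cons x→w step shortcut)
  ... | inj₁ unique with x ∈? w ∷ ys
  ...   | no x∉ = inj₁ (¬Any⇒All¬ (w ∷ ys) x∉ ∷ unique)
  ...   | yes x∈ = inj₂ (chasePath-suffix (w ∷ ys) cw x∈)

mainTheorem6 : (n : ℕ) (E : Graph n) (p : Fin n → ℚ) → IsDistribution p →
    (T : Fin n → ℚ∞) (v : Fin n) (ps : List (Fin n)) →
    IsShortestChasePath E p T v ps → Unique ps
mainTheorem6 n E p _ T v (x ∷ ps) (cx , refl , shortest)
  with chasePath-unique⊎shortcut E p T x ps cx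
... | inj₁ unique = unique
... | inj₂ (qs , cq , sq , lq) = ⊥-elim (1+n≰n (≤-trans (shortest qs cq sq) lq))
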